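{- Let $t,t'$ be distinct orderly bracketed strings of variables with $\check t=\check t'$. Then there exists an assignment $\mu:V\to\{e_0,\dots,e_7\}$ such that $t^\mu=e_4=-t'^\mu$.
   Context: The unit octonions $e_0,\dots,e_7$ multiply as follows: $e_0$ is a two-sided identity; $e_i^2=-e_0$ for $1\le i\le 7$; and for each triple $(i,j,k)\in\{(1,2,3),(1,4,5),(1,7,6),(2,4,6),(2,5,7),(3,4,7),(3,6,5)\}$, $e_ie_j=e_k$, $e_je_k=e_i$, $e_ke_i=e_j$, $e_je_i=-e_k$, $e_ke_j=-e_i$, $e_ie_k=-e_j$; products are extended bilinearly over $\mathbb{R}$. Let $V=\{x_0,x_1,\dots\}$ be a set of variables. Bracketed strings of $V$ are defined recursively: each $x_n$ is one, and if $t_1,t_2$ are, so is $(t_1t_2)$; $\check t$ is the string obtained by deleting brackets. A bracketed string is orderly if the indices of the variables occurring in it are strictly increasing from left to right (in particular each variable occurs at most once). An assignment is a function $\mu:V\to\{e_0,\dots,e_7\}$; $t^\mu$ is defined by $x_n^\mu=\mu(x_n)$ and $(t_1t_2)^\mu=t_1^\mu t_2^\mu$ (octonion product). -}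

module Defs where

open import Data.Nat using (ℕ)
open import Data.Fin using (Fin; zero; suc; _≟_)
open import Data.Integer using (ℤ; +_; -_; _+_; _*_)
open import Data.Product using (_×_; _,_)
open import Data.List using (List; []; _∷_; _++_)
open import Data.List.Relation.Unary.Linked using (Linked)
open import Data.Vec using (Vec; tabulate; lookup)
open import Data.Vec.Functional using (foldr)
open import Relation.Nullary using (yes; no)

import Data.Nat as N

-- All octonions that arise here (products of basis units)
-- have integer coordinates, and the ℤ-span of e_0..e_7 is closed under
-- the bilinear product; so we work with octonions with ℤ coefficients,
-- a subring of the real octonions (equality agrees with real equality).

Oct : Set
Oct = Vec ℤ 8

pattern f0 = zero
pattern f1 = suc zero
pattern f2 = suc (suc zero)
pattern f3 = suc (suc (suc zero))
pattern f4 = suc (suc (suc (suc zero)))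
pattern f5 = suc (suc (suc (suc (suc zero))))
pattern f6 = suc (suc (suc (suc (suc (suc zero)))))
pattern f7 = suc (suc (suc (suc (suc (suc (suc zero))))))

e : Fin 8 → Oct
e i = tabulate δ
  where
  δ : Fin 8 → ℤ
  δ j with i ≟ j
  ... | yes _ = + 1
  ... | no _  = + 0

-_ᴼ : Oct → Oct
- x ᴼ = Data.Vec.map -_ x

data Sign : Set where
  pos negs : Sign

sgn : Sign → ℤ
sgn pos  = + 1
sgn negs = - (+ 1)

-- Multiplication table of basis units: unitMul i j = (s , k) means
-- e_i e_j = ±e_k.  It is exactly the table of the paper: e_0 identity,
-- e_i² = -e_0, and for each triple (i,j,k) in
-- (1,2,3),(1,4,5),(1,7,6),(2,4,6),(2,5,7),(3,4,7),(3,6,5):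
-- e_ie_j=e_k, e_je_k=e_i, e_ke_i=e_j and the reversed products negated.
unitMul : Fin 8 → Fin 8 → Sign × Fin 8
unitMul f0 f0 = pos , f0
unitMul f0 f1 = pos , f1
unitMul f0 f2 = pos , f2
unitMul f0 f3 = pos , f3
unitMul f0 f4 = pos , f4
unitMul f0 f5 = pos , f5
unitMul f0 f6 = pos , f6
unitMul f0 f7 = pos , f7
unitMul f1 f0 = pos , f1
unitMul f1 f1 = negs , f0
unitMul f1 f2 = pos , f3
unitMul f1 f3 = negs , f2
unitMul f1 f4 = pos , f5
unitMul f1 f5 = negs , f4
unitMul f1 f6 = negs , f7
unitMul f1 f7 = pos , f6
unitMul f2 f0 = pos , f2
unitMul f2 f1 = negs , f3
unitMul f2 f2 = negs , f0
unitMul f2 f3 = pos , f1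
unitMul f2 f4 = pos , f6
unitMul f2 f5 = pos , f7
unitMul f2 f6 = negs , f4
unitMul f2 f7 = negs , f5
unitMul f3 f0 = pos , f3
unitMul f3 f1 = pos , f2
unitMul f3 f2 = negs , f1
unitMul f3 f3 = negs , f0
unitMul f3 f4 = pos , f7
unitMul f3 f5 = negs , f6
unitMul f3 f6 = pos , f5
unitMul f3 f7 = negs , f4
unitMul f4 f0 = pos , f4
unitMul f4 f1 = negs , f5
unitMul f4 f2 = negs , f6
unitMul f4 f3 = negs , f7
unitMul f4 f4 = negs , f0
unitMul f4 f5 = pos , f1
unitMul f4 f6 = pos , f2
unitMul f4 f7 = pos , f3
unitMul f5 f0 = pos , f5
unitMul f5 f1 = pos , f4
unitMul f5 f2 = negs , f7
unitMul f5 f3 = pos , f6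
unitMul f5 f4 = negs , f1
unitMul f5 f5 = negs , f0
unitMul f5 f6 = negs , f3
unitMul f5 f7 = pos , f2
unitMul f6 f0 = pos , f6
unitMul f6 f1 = pos , f7
unitMul f6 f2 = pos , f4
unitMul f6 f3 = negs , f5
unitMul f6 f4 = negs , f2
unitMul f6 f5 = pos , f3
unitMul f6 f6 = negs , f0
unitMul f6 f7 = negs , f1
unitMul f7 f0 = pos , f7
unitMul f7 f1 = negs , f6
unitMul f7 f2 = pos , f5
unitMul f7 f3 = pos , f4
unitMul f7 f4 = negs , f3
unitMul f7 f5 = negs , f2
unitMul f7 f6 = pos , f1
unitMul f7 f7 = negs , f0

sum8 : (Fin 8 → ℤ) → ℤ
sum8 g = foldr _+_ (+ 0) g

coeff : Sign × Fin 8 → Fin 8 → ℤ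
coeff (s , k) l with k ≟ l
... | yes _ = sgn s
... | no _  = + 0

_·_ : Oct → Oct → Oct
x · y = tabulate λ l →
  sum8 λ i → sum8 λ j → lookup x i * lookup y j * coeff (unitMul i j) l

-- Bracketed strings over V = {x_0, x_1, ...}; a leaf `var n` is x_n.

data BStr : Set where
  var : ℕ → BStr
  _⊗_ : BStr → BStr → BStr

unbracket : BStr → List ℕ
unbracket (var n) = n ∷ []
unbracket (t ⊗ u) = unbracket t ++ unbracket u

Orderly : BStr → Set
Orderly t = Linked N._<_ (unbracket t)

Assignment : Set
Assignment = ℕ → Fin 8

eval : BStr → Assignment → Oct
eval (var n) μ = e (μ n)
eval (t ⊗ u) μ = eval t μ · eval u μ

-- Two distinct bracketings of the same word of distinct letters already differ on three
-- of its letters a, b, c (in word order): restricted to {a, b, c}, one of them is (ab)c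
-- and the other a(bc).  This follows by induction on the top-level splits: if they are
-- at the same place, one of the two factors differs; otherwise take a from the left of
-- both splits, b between them and c from the right of both.  Sending every other
-- variable to e₀, which is invisible in a product, the two strings evaluate to (AB)C and
-- A(BC) for the units A, B, C assigned to a, b, c, and (e₂e₁)e₇ = e₄ = -(e₂(e₁e₇)).
module Submission where

open import Defs
open import Data.Product using (Σ; _×_; _,_; proj₁; proj₂)
open import Relation.Binary.PropositionalEquality using (_≡_; _≢_)

open import Data.Nat using (ℕ; _≟_)
open import Data.Nat.Properties using (<⇒≢; <-trans)
open import Data.Fin as Fin using (Fin)
open import Data.Fin.Properties using (all?)
open import Data.Integer.Properties using () renaming (_≟_ to _≟ℤ_)
open import Data.Vec.Properties using (≡-dec)
open import Data.Product.Properties using () renaming (≡-dec to ×-≡-dec)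
open import Data.Sum as Sum using (_⊎_; inj₁; inj₂)
open import Data.Maybe using (Maybe; just; nothing)
open import Data.List using (List; []; _∷_; _++_; filter)
open import Data.List.Properties using (∷-injective; ++-identityʳ; ++-conicalʳ; filter-++; filter-accept; filter-none)
open import Data.List.Relation.Unary.All as All using (All; []; _∷_)
open import Data.List.Relation.Unary.All.Properties using (All¬⇒¬Any; ++⁻ˡ; ++⁻ʳ)
open import Data.List.Relation.Unary.AllPairs as AllPairs using (AllPairs; []; _∷_)
open import Data.List.Relation.Unary.Any using (here; there)
open import Data.List.Relation.Unary.Linked.Properties using (Linked⇒AllPairs)
open import Data.List.Relation.Unary.Unique.Propositional using (Unique)
open import Data.List.Relation.Unary.Unique.Propositional.Properties as Unique using ()
open import Data.List.Membership.Propositional using (_∈_; _∉_)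
open import Data.List.Membership.Propositional.Properties using (∈-++⁺ˡ; ∈-++⁺ʳ; ∈-filter⁻)
open import Data.List.Membership.DecPropositional _≟_ using (_∈?_)
open import Data.Empty using (⊥-elim)
open import Function using (_∘_)
open import Level using (0ℓ)
open import Relation.Nullary using (Dec; yes; no; ¬_)
open import Relation.Nullary.Decidable using (from-yes; map′; _×-dec_)
open import Relation.Unary using (Pred; Decidable)
open import Relation.Binary.Definitions using (DecidableEquality)
open import Relation.Binary.PropositionalEquality
  using (refl; sym; trans; cong; cong₂; subst; ≢-sym; module ≡-Reasoning)

open ≡-Reasoning

-- Products of basis units are signed units ±e_k, so octonion evaluation of a bracketed
-- string under an assignment factors through this finite multiplication.

_*ˢ_ : Sign → Sign → Sign
pos  *ˢ s    = s
negs *ˢ pos  = negs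
negs *ˢ negs = pos

SignedUnit : Set
SignedUnit = Sign × Fin 8

unit : Fin 8 → SignedUnit
unit i = pos , i

infixl 7 _⊙_
_⊙_ : SignedUnit → SignedUnit → SignedUnit
(s , i) ⊙ (s′ , j) = let (s″ , k) = unitMul i j in (s *ˢ s′) *ˢ s″ , k

⟦_⟧ : SignedUnit → Oct
⟦ pos  , k ⟧ = e k
⟦ negs , k ⟧ = - e k ᴼ

_≟ˢ_ : DecidableEquality Sign
pos  ≟ˢ pos  = yes refl
negs ≟ˢ negs = yes refl
pos  ≟ˢ negs = no λ ()
negs ≟ˢ pos  = no λ ()

infix 4 _≟ˢ_ _≟ᵘ_
_≟ᵘ_ : DecidableEquality SignedUnit
_≟ᵘ_ = ×-≡-dec _≟ˢ_ Fin._≟_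

all-units? : {P : Pred SignedUnit 0ℓ} → Decidable P → Dec (∀ x → P x)
all-units? P? = map′ (λ (p , n) → λ { (pos , i) → p i ; (negs , i) → n i })
                     (λ h → (λ i → h (pos , i)) , (λ i → h (negs , i)))
                     (all? (λ i → P? (pos , i)) ×-dec all? (λ i → P? (negs , i)))

⟦⟧-⊙ : ∀ x y → ⟦ x ⟧ · ⟦ y ⟧ ≡ ⟦ x ⊙ y ⟧
⟦⟧-⊙ = from-yes (all-units? λ x → all-units? λ y → ≡-dec _≟ℤ_ (⟦ x ⟧ · ⟦ y ⟧) ⟦ x ⊙ y ⟧)

⊙-identityˡ : ∀ x → unit f0 ⊙ x ≡ x
⊙-identityˡ = from-yes (all-units? λ x → unit f0 ⊙ x ≟ᵘ x)

⊙-identityʳ : ∀ x → x ⊙ unit f0 ≡ x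
⊙-identityʳ = from-yes (all-units? λ x → x ⊙ unit f0 ≟ᵘ x)

evalᵘ : BStr → Assignment → SignedUnit
evalᵘ (var n) μ = unit (μ n)
evalᵘ (t ⊗ u) μ = evalᵘ t μ ⊙ evalᵘ u μ

eval≡⟦evalᵘ⟧ : ∀ t μ → eval t μ ≡ ⟦ evalᵘ t μ ⟧
eval≡⟦evalᵘ⟧ (var n) μ = refl
eval≡⟦evalᵘ⟧ (t ⊗ u) μ = trans (cong₂ _·_ (eval≡⟦evalᵘ⟧ t μ) (eval≡⟦evalᵘ⟧ u μ)) (⟦⟧-⊙ (evalᵘ t μ) (evalᵘ u μ))

module _ {a r} {A : Set a} {R : A → A → Set r} where

  allPairs-++⁻ˡ : ∀ xs {ys} → AllPairs R (xs ++ ys) → AllPairs R xs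
  allPairs-++⁻ˡ []       _          = []
  allPairs-++⁻ˡ (x ∷ xs) (rx ∷ rxs) = ++⁻ˡ xs rx ∷ allPairs-++⁻ˡ xs rxs

  allPairs-++⁻ʳ : ∀ xs {ys} → AllPairs R (xs ++ ys) → AllPairs R ys
  allPairs-++⁻ʳ []       rs        = rs
  allPairs-++⁻ʳ (x ∷ xs) (_ ∷ rxs) = allPairs-++⁻ʳ xs rxs

  allPairs-++-cross : ∀ xs {ys x y} → AllPairs R (xs ++ ys) → x ∈ xs → y ∈ ys → R x y
  allPairs-++-cross (x ∷ xs) (rx ∷ _)   (here refl) y∈ = All.lookup (++⁻ʳ xs rx) y∈
  allPairs-++-cross (x ∷ xs) (_ ∷ rxs) (there x∈)  y∈ = allPairs-++-cross xs rxs x∈ y∈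

data Splittings {a} {A : Set a} (xs ys xs′ ys′ : List A) : Set a where
  same    : xs ≡ xs′ → ys ≡ ys′ → Splittings xs ys xs′ ys′
  shorter : ∀ b m → xs′ ≡ xs ++ b ∷ m → ys ≡ b ∷ m ++ ys′ → Splittings xs ys xs′ ys′
  longer  : ∀ b m → xs ≡ xs′ ++ b ∷ m → ys′ ≡ b ∷ m ++ ys → Splittings xs ys xs′ ys′

splittings : ∀ {a} {A : Set a} (xs ys xs′ ys′ : List A) →
             xs ++ ys ≡ xs′ ++ ys′ → Splittings xs ys xs′ ys′
splittings []       ys []         ys′ eq = same refl eq
splittings []       ys (x′ ∷ xs′) ys′ eq = shorter x′ xs′ refl eq
splittings (x ∷ xs) ys []         ys′ eq = longer x xs refl (sym eq)
splittings (x ∷ xs) ys (x′ ∷ xs′) ys′ eq with ∷-injective eq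
... | refl , eq′ with splittings xs ys xs′ ys′ eq′
...   | same p q        = same (cong (x ∷_) p) q
...   | shorter b m p q = shorter b m (cong (x ∷_) p) q
...   | longer b m p q  = longer b m (cong (x ∷_) p) q

_≟ᵇ_ : DecidableEquality BStr
var m ≟ᵇ var n with m ≟ n
... | yes refl = yes refl
... | no m≢n   = no λ { refl → m≢n refl }
var _ ≟ᵇ (_ ⊗ _) = no λ ()
(_ ⊗ _) ≟ᵇ var _ = no λ ()
(t ⊗ u) ≟ᵇ (t′ ⊗ u′) with t ≟ᵇ t′ | u ≟ᵇ u′
... | yes refl | yes refl = yes refl
... | no t≢t′  | _        = no λ { refl → t≢t′ refl }
... | yes _    | no u≢u′  = no λ { refl → u≢u′ refl }

unbracket-head : ∀ t → Σ ℕ λ x → Σ (List ℕ) λ xs → unbracket t ≡ x ∷ xs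
unbracket-head (var n) = n , [] , refl
unbracket-head (t ⊗ u) =
  let x , xs , eq = unbracket-head t in x , xs ++ unbracket u , cong (_++ unbracket u) eq

unbracket-⊗≢[x] : ∀ {x} t u → unbracket (t ⊗ u) ≢ x ∷ []
unbracket-⊗≢[x] t u eq with unbracket-head t | unbracket-head u
... | _ , xs , p | _ , ys , q rewrite p | q
  with () ← ++-conicalʳ xs (_ ∷ ys) (proj₂ (∷-injective eq))

unbracket≡[x]⇒var : ∀ {x} t → unbracket t ≡ x ∷ [] → t ≡ var x
unbracket≡[x]⇒var (var n) refl = refl
unbracket≡[x]⇒var (t ⊗ u) eq   = ⊥-elim (unbracket-⊗≢[x] t u eq)

unbracket≡[x,y]⇒var⊗var : ∀ {x y} t → unbracket t ≡ x ∷ y ∷ [] → t ≡ var x ⊗ var y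
unbracket≡[x,y]⇒var⊗var (var n) ()
unbracket≡[x,y]⇒var⊗var (t ⊗ u) eq with unbracket-head t | unbracket-head u
... | _ , [] , p | _ , _ , q =
  let t≡x , rest = ∷-injective (trans (sym (cong (_++ unbracket u) p)) eq)
  in cong₂ _⊗_ (unbracket≡[x]⇒var t (trans p (cong (_∷ []) t≡x)))
               (unbracket≡[x]⇒var u rest)
... | _ , _ ∷ xs , p | _ , ys , q rewrite p | q
  with () ← ++-conicalʳ xs (_ ∷ ys) (proj₂ (∷-injective (proj₂ (∷-injective eq))))

module Restriction {p} {P : Pred ℕ p} (P? : Decidable P) where

  infixl 6 _⊗ᴹ_
  _⊗ᴹ_ : Maybe BStr → Maybe BStr → Maybe BStr
  nothing ⊗ᴹ m       = m
  just t  ⊗ᴹ nothing = just t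
  just t  ⊗ᴹ just u  = just (t ⊗ u)

  restrict : BStr → Maybe BStr
  restrict (var n) with P? n
  ... | yes _ = just (var n)
  ... | no _  = nothing
  restrict (t ⊗ u) = restrict t ⊗ᴹ restrict u

  unbracketᴹ : Maybe BStr → List ℕ
  unbracketᴹ nothing  = []
  unbracketᴹ (just t) = unbracket t

  evalᴹ : Maybe BStr → Assignment → SignedUnit
  evalᴹ nothing  μ = unit f0
  evalᴹ (just t) μ = evalᵘ t μ

  unbracketᴹ-⊗ᴹ : ∀ m m′ → unbracketᴹ (m ⊗ᴹ m′) ≡ unbracketᴹ m ++ unbracketᴹ m′
  unbracketᴹ-⊗ᴹ nothing  m′       = refl
  unbracketᴹ-⊗ᴹ (just t) nothing  = sym (++-identityʳ (unbracket t))
  unbracketᴹ-⊗ᴹ (just t) (just u) = refl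

  evalᴹ-⊗ᴹ : ∀ m m′ μ → evalᴹ (m ⊗ᴹ m′) μ ≡ evalᴹ m μ ⊙ evalᴹ m′ μ
  evalᴹ-⊗ᴹ nothing  m′       μ = sym (⊙-identityˡ (evalᴹ m′ μ))
  evalᴹ-⊗ᴹ (just t) nothing  μ = sym (⊙-identityʳ (evalᵘ t μ))
  evalᴹ-⊗ᴹ (just t) (just u) μ = refl

  unbracket-restrict : ∀ t → unbracketᴹ (restrict t) ≡ filter P? (unbracket t)
  unbracket-restrict (var n) with P? n
  ... | yes _ = refl
  ... | no _  = refl
  unbracket-restrict (t ⊗ u) = begin
    unbracketᴹ (restrict t ⊗ᴹ restrict u)
      ≡⟨ unbracketᴹ-⊗ᴹ (restrict t) (restrict u) ⟩
    unbracketᴹ (restrict t) ++ unbracketᴹ (restrict u)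
      ≡⟨ cong₂ _++_ (unbracket-restrict t) (unbracket-restrict u) ⟩
    filter P? (unbracket t) ++ filter P? (unbracket u)
      ≡⟨ filter-++ P? (unbracket t) (unbracket u) ⟨
    filter P? (unbracket (t ⊗ u)) ∎

  evalᵘ-restrict : ∀ {μ} → (∀ {n} → ¬ P n → μ n ≡ f0) →
                   ∀ t → evalᵘ t μ ≡ evalᴹ (restrict t) μ
  evalᵘ-restrict off (var n) with P? n
  ... | yes _  = refl
  ... | no ¬Pn = cong unit (off ¬Pn)
  evalᵘ-restrict {μ} off (t ⊗ u) = begin
    evalᵘ t μ ⊙ evalᵘ u μ
      ≡⟨ cong₂ _⊙_ (evalᵘ-restrict off t) (evalᵘ-restrict off u) ⟩
    evalᴹ (restrict t) μ ⊙ evalᴹ (restrict u) μ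
      ≡⟨ evalᴹ-⊗ᴹ (restrict t) (restrict u) μ ⟨
    evalᴹ (restrict (t ⊗ u)) μ ∎

  restrict-none : ∀ t → (∀ {y} → y ∈ unbracket t → ¬ P y) → restrict t ≡ nothing
  restrict-none (var n) none with P? n
  ... | yes Pn = ⊥-elim (none (here refl) Pn)
  ... | no _   = refl
  restrict-none (t ⊗ u) none
    rewrite restrict-none t (none ∘ ∈-++⁺ˡ) | restrict-none u (none ∘ ∈-++⁺ʳ (unbracket t))
    = refl

  restrict-sub : ∀ t {X y} → restrict t ≡ just X → y ∈ unbracket X → y ∈ unbracket t
  restrict-sub t r y∈X =
    proj₁ (∈-filter⁻ P? (subst (_ ∈_) (trans (cong unbracketᴹ (sym r)) (unbracket-restrict t)) y∈X))

  restrict-unique : ∀ t {X} → Unique (unbracket t) → restrict t ≡ just X → Unique (unbracket X)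
  restrict-unique t u r =
    subst Unique (trans (sym (unbracket-restrict t)) (cong unbracketᴹ r)) (Unique.filter⁺ P? u)

  restrict≡var : ∀ t {x} → filter P? (unbracket t) ≡ x ∷ [] → restrict t ≡ just (var x)
  restrict≡var t eq with restrict t | unbracket-restrict t
  ... | nothing | p with () ← trans p eq
  ... | just X  | p = cong just (unbracket≡[x]⇒var X (trans p eq))

  restrict≡var⊗var : ∀ t {x y} → filter P? (unbracket t) ≡ x ∷ y ∷ [] →
                     restrict t ≡ just (var x ⊗ var y)
  restrict≡var⊗var t eq with restrict t | unbracket-restrict t
  ... | nothing | p with () ← trans p eq
  ... | just X  | p = cong just (unbracket≡[x,y]⇒var⊗var X (trans p eq))

open Restriction using (restrict; restrict-none; restrict-sub)

infix 4.5 _↾_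
_↾_ : BStr → List ℕ → Maybe BStr
t ↾ zs = restrict (_∈? zs) t

↾-⊗ˡ : ∀ t u {X} → Unique (unbracket t ++ unbracket u) →
       t ↾ unbracket X ≡ just X → t ⊗ u ↾ unbracket X ≡ just X
↾-⊗ˡ t u tu r rewrite r | restrict-none (_∈? _) u (λ y∈u y∈X →
  allPairs-++-cross (unbracket t) tu (restrict-sub (_∈? _) t r y∈X) y∈u refl) = refl

↾-⊗ʳ : ∀ t u {X} → Unique (unbracket t ++ unbracket u) →
       u ↾ unbracket X ≡ just X → t ⊗ u ↾ unbracket X ≡ just X
↾-⊗ʳ t u tu r rewrite r | restrict-none (_∈? _) t (λ y∈t y∈X →
  allPairs-++-cross (unbracket t) tu y∈t (restrict-sub (_∈? _) u r y∈X) refl) = refl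

record AssocWitness (t t′ : BStr) : Set where
  constructor witness
  field
    a b c    : ℕ
    t-left   : t  ↾ a ∷ b ∷ c ∷ [] ≡ just ((var a ⊗ var b) ⊗ var c)
    t′-right : t′ ↾ a ∷ b ∷ c ∷ [] ≡ just (var a ⊗ (var b ⊗ var c))

witness-⊗ˡ : ∀ {t u t′ u′} → Unique (unbracket t ++ unbracket u) → Unique (unbracket t′ ++ unbracket u′) →
             AssocWitness t t′ → AssocWitness (t ⊗ u) (t′ ⊗ u′)
witness-⊗ˡ {t} {u} {t′} {u′} tu tu′ (witness a b c l r) =
  witness a b c (↾-⊗ˡ t u tu l) (↾-⊗ˡ t′ u′ tu′ r)

witness-⊗ʳ : ∀ {t u t′ u′} → Unique (unbracket t ++ unbracket u) → Unique (unbracket t′ ++ unbracket u′) →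
             AssocWitness u u′ → AssocWitness (t ⊗ u) (t′ ⊗ u′)
witness-⊗ʳ {t} {u} {t′} {u′} tu tu′ (witness a b c l r) =
  witness a b c (↾-⊗ʳ t u tu l) (↾-⊗ʳ t′ u′ tu′ r)

filter-block-heads : ∀ {a b c} ru m rv → Unique ((a ∷ ru) ++ (b ∷ m) ++ (c ∷ rv)) →
  let Q = _∈? a ∷ b ∷ c ∷ [] in
  filter Q (a ∷ ru) ≡ a ∷ [] × filter Q (b ∷ m) ≡ b ∷ [] × filter Q (c ∷ rv) ≡ c ∷ []
filter-block-heads {a} {b} {c} ru m rv uniq =
    block ru (here refl)
      (λ y∈ → ≢-sym (All.lookup a∉ru y∈) , A#BC (there y∈) (here refl)
                , A#BC (there y∈) (∈-++⁺ʳ (b ∷ m) (here refl)))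
  , block m (there (here refl))
      (λ y∈ → ≢-sym (A#BC (here refl) (there (∈-++⁺ˡ y∈))) , ≢-sym (All.lookup b∉m y∈)
                , B#C (there y∈) (here refl))
  , block rv (there (there (here refl)))
      (λ y∈ → ≢-sym (A#BC (here refl) (∈-++⁺ʳ (b ∷ m) (there y∈)))
                , ≢-sym (B#C (here refl) (there y∈)) , ≢-sym (All.lookup c∉rv y∈))
  where
  abc : List ℕ
  abc = a ∷ b ∷ c ∷ []

  uBC : Unique ((b ∷ m) ++ (c ∷ rv))
  uBC = allPairs-++⁻ʳ (a ∷ ru) uniq

  a∉ru : All (a ≢_) ru
  a∉ru = AllPairs.head (allPairs-++⁻ˡ (a ∷ ru) uniq)

  b∉m : All (b ≢_) m
  b∉m = AllPairs.head (allPairs-++⁻ˡ (b ∷ m) uBC)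

  c∉rv : All (c ≢_) rv
  c∉rv = AllPairs.head (allPairs-++⁻ʳ (b ∷ m) uBC)

  A#BC : ∀ {x y} → x ∈ a ∷ ru → y ∈ (b ∷ m) ++ (c ∷ rv) → x ≢ y
  A#BC = allPairs-++-cross (a ∷ ru) uniq

  B#C : ∀ {x y} → x ∈ b ∷ m → y ∈ c ∷ rv → x ≢ y
  B#C = allPairs-++-cross (b ∷ m) uBC

  block : ∀ {x} r → x ∈ abc → (∀ {y} → y ∈ r → y ≢ a × y ≢ b × y ≢ c) →
          filter (_∈? abc) (x ∷ r) ≡ x ∷ []
  block _ x∈ other = trans (filter-accept (_∈? abc) x∈) (cong (_ ∷_) (filter-none (_∈? abc)
    (All.tabulate λ y∈ → let y≢a , y≢b , y≢c = other y∈ in All¬⇒¬Any (y≢a ∷ y≢b ∷ y≢c ∷ []))))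

witness-split : ∀ t u t′ u′ {b m} → unbracket t′ ≡ unbracket t ++ b ∷ m →
                unbracket u ≡ b ∷ m ++ unbracket u′ → Unique (unbracket (t ⊗ u)) →
                AssocWitness (t′ ⊗ u′) (t ⊗ u)
witness-split t u t′ u′ {b} {m} t′≡ u≡ uniq
  with unbracket-head t | unbracket-head u′
... | a , ru , t≡ | c , rv , u′≡ =
  let fA , fB , fC = filter-block-heads ru m rv (subst Unique (cong₂ _++_ t≡ u≡bmcrv) uniq) in
  witness a b c
    (cong₂ _⊗ᴹ_ (restrict≡var⊗var t′ (begin
        filter Q (unbracket t′)            ≡⟨ cong (filter Q) (trans t′≡ (cong (_++ b ∷ m) t≡)) ⟩
        filter Q ((a ∷ ru) ++ (b ∷ m))     ≡⟨ filter-++ Q (a ∷ ru) (b ∷ m) ⟩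
        filter Q (a ∷ ru) ++ filter Q (b ∷ m) ≡⟨ cong₂ _++_ fA fB ⟩
        a ∷ b ∷ []                         ∎))
      (restrict≡var u′ (trans (cong (filter Q) u′≡) fC)))
    (cong₂ _⊗ᴹ_ (restrict≡var t (trans (cong (filter Q) t≡) fA))
      (restrict≡var⊗var u (begin
        filter Q (unbracket u)             ≡⟨ cong (filter Q) u≡bmcrv ⟩
        filter Q ((b ∷ m) ++ (c ∷ rv))     ≡⟨ filter-++ Q (b ∷ m) (c ∷ rv) ⟩
        filter Q (b ∷ m) ++ filter Q (c ∷ rv) ≡⟨ cong₂ _++_ fB fC ⟩
        b ∷ c ∷ []                         ∎)))
  where
  Q : Decidable (_∈ a ∷ b ∷ c ∷ [])
  Q = _∈? a ∷ b ∷ c ∷ []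
  open Restriction Q using (_⊗ᴹ_; restrict≡var; restrict≡var⊗var)

  u≡bmcrv : unbracket u ≡ (b ∷ m) ++ (c ∷ rv)
  u≡bmcrv = trans u≡ (cong (λ ys → b ∷ m ++ ys) u′≡)

assocWitness : ∀ t t′ → Unique (unbracket t) → Unique (unbracket t′) → t ≢ t′ →
               unbracket t ≡ unbracket t′ → AssocWitness t t′ ⊎ AssocWitness t′ t
assocWitness (var m) (var n) _ _ t≢t′ refl = ⊥-elim (t≢t′ refl)
assocWitness (var m) (t′ ⊗ u′) _ _ _ eq = ⊥-elim (unbracket-⊗≢[x] t′ u′ (sym eq))
assocWitness (t ⊗ u) (var n) _ _ _ eq = ⊥-elim (unbracket-⊗≢[x] t u eq)
assocWitness (t ⊗ u) (t′ ⊗ u′) tu tu′ t≢t′ eq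
  with splittings (unbracket t) (unbracket u) (unbracket t′) (unbracket u′) eq
... | shorter b m p q = inj₂ (witness-split t u t′ u′ p q tu)
... | longer b m p q  = inj₁ (witness-split t′ u′ t u p q tu′)
... | same p q with t ≟ᵇ t′
...   | yes refl = Sum.map (witness-⊗ʳ tu tu′) (witness-⊗ʳ tu′ tu)
                     (assocWitness u u′ (allPairs-++⁻ʳ (unbracket t) tu) (allPairs-++⁻ʳ (unbracket t′) tu′)
                                   (λ { refl → t≢t′ refl }) q)
...   | no t≢t′ = Sum.map (witness-⊗ˡ tu tu′) (witness-⊗ˡ tu′ tu)
                    (assocWitness t t′ (allPairs-++⁻ˡ (unbracket t) tu) (allPairs-++⁻ˡ (unbracket t′) tu′)
                                  t≢t′ p)

infixl 6 _[_↦_]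
_[_↦_] : Assignment → ℕ → Fin 8 → Assignment
(μ [ a ↦ A ]) n with n ≟ a
... | yes _ = A
... | no _  = μ n

[↦]-same : ∀ μ a A → (μ [ a ↦ A ]) a ≡ A
[↦]-same μ a A with a ≟ a
... | yes _  = refl
... | no a≢a = ⊥-elim (a≢a refl)

[↦]-other : ∀ μ {a} A {n} → n ≢ a → (μ [ a ↦ A ]) n ≡ μ n
[↦]-other μ {a} A {n} n≢a with n ≟ a
... | yes n≡a = ⊥-elim (n≢a n≡a)
... | no _    = refl

realise : ∀ {t t′} → AssocWitness t t′ → Unique (unbracket t) → (A B C : Fin 8) →
          Σ Assignment λ μ → eval t  μ ≡ ⟦ unit A ⊙ unit B ⊙ unit C ⟧
                           × eval t′ μ ≡ ⟦ unit A ⊙ (unit B ⊙ unit C) ⟧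
realise {t} {t′} (witness a b c t-left t′-right) uniq A B C =
  μ , trans (value t t-left) (cong ⟦_⟧ (at-abc λ x y z → x ⊙ y ⊙ z))
    , trans (value t′ t′-right) (cong ⟦_⟧ (at-abc λ x y z → x ⊙ (y ⊙ z)))
  where
  abc : List ℕ
  abc = a ∷ b ∷ c ∷ []
  open Restriction (_∈? abc) using (evalᴹ; evalᵘ-restrict; restrict-unique)

  μ : Assignment
  μ = (λ _ → f0) [ c ↦ C ] [ b ↦ B ] [ a ↦ A ]

  distinct : Unique abc
  distinct = restrict-unique t uniq t-left

  a≢b : a ≢ b
  a≢b = All.lookup (AllPairs.head distinct) (here refl)

  a≢c : a ≢ c
  a≢c = All.lookup (AllPairs.head distinct) (there (here refl))

  b≢c : b ≢ c
  b≢c = All.lookup (AllPairs.head (AllPairs.tail distinct)) (here refl)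

  μ-off : ∀ {n} → n ∉ abc → μ n ≡ f0
  μ-off n∉ = trans ([↦]-other _ A (n∉ ∘ here)) (trans ([↦]-other _ B (n∉ ∘ there ∘ here))
                   ([↦]-other _ C (n∉ ∘ there ∘ there ∘ here)))

  at-abc : ∀ (f : SignedUnit → SignedUnit → SignedUnit → SignedUnit) →
           f (unit (μ a)) (unit (μ b)) (unit (μ c)) ≡ f (unit A) (unit B) (unit C)
  at-abc f = cong₂ (λ x (y , z) → f x y z) (cong unit μ-a) (cong₂ _,_ (cong unit μ-b) (cong unit μ-c))
    where
    μ-a : μ a ≡ A
    μ-a = [↦]-same _ a A
    μ-b : μ b ≡ B
    μ-b = trans ([↦]-other _ A (≢-sym a≢b)) ([↦]-same _ b B)
    μ-c : μ c ≡ C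
    μ-c = trans ([↦]-other _ A (≢-sym a≢c)) (trans ([↦]-other _ B (≢-sym b≢c)) ([↦]-same _ c C))

  value : ∀ s {X} → s ↾ abc ≡ just X → eval s μ ≡ ⟦ evalᵘ X μ ⟧
  value s {X} r = begin
    eval s μ                  ≡⟨ eval≡⟦evalᵘ⟧ s μ ⟩
    ⟦ evalᵘ s μ ⟧             ≡⟨ cong ⟦_⟧ (evalᵘ-restrict μ-off s) ⟩
    ⟦ evalᴹ (s ↾ abc) μ ⟧     ≡⟨ cong (λ m → ⟦ evalᴹ m μ ⟧) r ⟩
    ⟦ evalᵘ X μ ⟧             ∎

orderly⇒unique : ∀ t → Orderly t → Unique (unbracket t)
orderly⇒unique _ o = AllPairs.map <⇒≢ (Linked⇒AllPairs <-trans o)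

-- When t′ is the left-associated one, (e₁e₂)e₇ = -e₄ = -(e₁(e₂e₇)) is used instead.
mainTheorem6 : (t t′ : BStr) → Orderly t → Orderly t′ → t ≢ t′ →
    unbracket t ≡ unbracket t′ →
    Σ Assignment (λ μ → (eval t μ ≡ e f4) × (eval t′ μ ≡ - e f4 ᴼ))
mainTheorem6 t t′ o o′ t≢t′ t≈t′
  with assocWitness t t′ (orderly⇒unique t o) (orderly⇒unique t′ o′) t≢t′ t≈t′
... | inj₁ w = realise w (orderly⇒unique t o) f2 f1 f7
... | inj₂ w = let μ , t′≡ , t≡ = realise w (orderly⇒unique t′ o′) f1 f2 f7 in μ , t≡ , t′≡
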